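{- A bipartite graph $G=(V,E)$ without isolated vertices is a unique key graph if and only if $E$ is a perfect matching of $G$.
   Context: A pure Horn clause $A\to v$ ($A\subseteq V$, $v\in V$) stands for $v\vee\bigvee_{a\in A}\bar a$; a Boolean function $h:\{0,1\}^V\to\{0,1\}$ is pure Horn if it is a conjunction of such clauses; $A\to v$ is an implicate of $h$ if every true point of $h$ satisfies it; $K\subseteq V$ is a key of $h$ if $K\to w$ is an implicate for all $w\in V\setminus K$; $\mathcal{K}(h)$ is the family of minimal keys. A Sperner hypergraph $\mathcal{B}\subseteq 2^V$ is a unique key hypergraph if there is exactly one pure Horn function $h$ on $V$ with $\mathcal{K}(h)=\mathcal{B}$. A graph $G=(V,E)$ is a unique key graph if $E$, viewed as a hypergraph of $2$-element subsets of $V$, is a unique key hypergraph. -}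

module Defs where

open import Data.Nat using (ℕ; suc)
open import Data.Bool using (Bool; true; false)
open import Data.Fin using (Fin)
open import Data.Fin.Subset using (Subset; _∈_; _∉_; _⊂_; ⁅_⁆; _∪_)
open import Data.List using (List)
open import Data.List.Relation.Unary.All using (All)
open import Data.Product using (Σ; ∃; _×_; _,_)
open import Relation.Binary.PropositionalEquality using (_≡_; _≢_)
open import Relation.Nullary using (¬_)
open import Function.Bundles using (_⇔_)

Point : ℕ → Set
Point n = Fin n → Bool

BoolFun : ℕ → Set
BoolFun n = Point n → Bool

-- A pure Horn clause A → v, encoded as the pair (A , v).
HornClause : ℕ → Set
HornClause n = Subset n × Fin n

SatClause : ∀ {n} → Point n → HornClause n → Set
SatClause x (A , v) = (∀ a → a ∈ A → x a ≡ true) → x v ≡ true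

PureHorn : ∀ {n} → BoolFun n → Set
PureHorn {n} h = Σ (List (HornClause n)) λ cs →
  ∀ x → (h x ≡ true) ⇔ All (SatClause x) cs

Implicate : ∀ {n} → BoolFun n → Subset n → Fin n → Set
Implicate h A v = ∀ x → h x ≡ true → SatClause x (A , v)

Key : ∀ {n} → BoolFun n → Subset n → Set
Key h K = ∀ w → w ∉ K → Implicate h K w

MinimalKey : ∀ {n} → BoolFun n → Subset n → Set
MinimalKey h K = Key h K × (∀ K′ → K′ ⊂ K → ¬ Key h K′)

Hypergraph : ℕ → Set₁
Hypergraph n = Subset n → Set

KeysEqual : ∀ {n} → BoolFun n → Hypergraph n → Set
KeysEqual h ℬ = ∀ K → MinimalKey h K ⇔ ℬ K

UniqueKeyHypergraph : ∀ {n} → Hypergraph n → Set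
UniqueKeyHypergraph {n} ℬ =
  (Σ (BoolFun n) λ h → PureHorn h × KeysEqual h ℬ) ×
  (∀ h₁ h₂ → PureHorn h₁ → KeysEqual h₁ ℬ → PureHorn h₂ → KeysEqual h₂ ℬ →
     ∀ x → h₁ x ≡ h₂ x)

record Graph (n : ℕ) : Set where
  field
    adj   : Fin n → Fin n → Bool
    sym   : ∀ u v → adj u v ≡ true → adj v u ≡ true
    irrefl : ∀ v → adj v v ≡ false

open Graph public

EdgeHypergraph : ∀ {n} → Graph n → Hypergraph n
EdgeHypergraph {n} G K = Σ (Fin n) λ u → Σ (Fin n) λ v →
  adj G u v ≡ true × K ≡ ⁅ u ⁆ ∪ ⁅ v ⁆

UniqueKeyGraph : ∀ {n} → Graph n → Set
UniqueKeyGraph G = UniqueKeyHypergraph (EdgeHypergraph G)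

Bipartite : ∀ {n} → Graph n → Set
Bipartite {n} G = Σ (Fin n → Bool) λ c →
  ∀ u v → adj G u v ≡ true → c u ≢ c v

NoIsolatedVertices : ∀ {n} → Graph n → Set
NoIsolatedVertices {n} G = ∀ v → Σ (Fin n) λ u → adj G v u ≡ true

PerfectMatching : ∀ {n} → Graph n → Set
PerfectMatching {n} G = ∀ v → Σ (Fin n) λ u →
  adj G v u ≡ true × (∀ w → adj G v w ≡ true → w ≡ u)

module Submission where

-- A point x is edge-closed if it is everywhere true once it contains an edge;
-- these are the true points of the pure Horn closure function (clauses {u,v} → z).
-- 1. For any h: every key contains a minimal key (well-founded induction on ⊂).
-- 2. The minimal keys of h are the edges iff every edge is a key and no
--    independent set is; every edge is a key iff all true points are edge-closed.
-- 3. Perfect matching ⇒ unique: an implicate A → v with A independent, v ∉ A,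
--    would make A ∪ {partner of v} an independent key; so the true points of
--    any such h are exactly the edge-closed points.
-- 4. Fork ⇒ not unique: some vertex w has no pendant neighbour; with I the other
--    vertices of w's colour, adding the clause I → w keeps the minimal keys but
--    rejects the point of I.
-- Without isolated vertices, E is a perfect matching or there is a fork.

open import Defs hiding (sym)
open import Data.Nat using (ℕ; suc)
open import Data.Bool using (Bool; true; false)
open import Data.Bool.Properties using (¬-not) renaming (_≟_ to _≟ᵇ_)
open import Data.Fin using (Fin; zero)
open import Data.Fin.Properties using (all?; any?; ¬∀⟶∃¬) renaming (_≟_ to _≟ᶠ_)
open import Data.Fin.Subset using (Subset; _∈_; _∉_; _⊆_; _⊂_; ⁅_⁆; _∪_)
open import Data.Fin.Subset.Properties
  using (_∈?_; _⊆?_; x∈⁅x⁆; x∈⁅y⁆⇒x≡y; x∈p∪q⁻; x∈p∪q⁺; p⊆p∪q; ⊆-refl; ⊆-trans; ⊆-antisym)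
open import Data.Fin.Subset.Induction using (⊂-wellFounded)
open import Data.Vec using (lookup; tabulate)
open import Data.Vec.Properties using (lookup⇒[]=; []=⇒lookup; lookup∘tabulate)
open import Data.List using (List; _∷_; map; filter; cartesianProduct; allFin)
open import Data.List.Relation.Unary.All as All using (All; _∷_)
open import Data.List.Membership.Propositional using () renaming (_∈_ to _∈ˡ_)
open import Data.List.Membership.Propositional.Properties
  using (∈-map⁺; ∈-map⁻; ∈-filter⁺; ∈-filter⁻; ∈-cartesianProduct⁺; ∈-allFin)
open import Data.Product using (∃; _×_; _,_; proj₁; proj₂)
open import Data.Sum using (_⊎_; inj₁; inj₂; [_,_])
open import Data.Empty using (⊥; ⊥-elim)
open import Function using (id)
open import Induction.WellFounded using (Acc; acc)
open import Relation.Nullary using (¬_; Dec; yes; no; does; contradiction)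
open import Relation.Nullary.Decidable using (dec-true; decidable-stable; _×-dec_; _→-dec_; ¬?)
open import Relation.Unary using (Pred; Decidable)
open import Relation.Binary.PropositionalEquality using (_≡_; _≢_; refl; sym; trans; subst; ≢-sym)
open import Function.Bundles using (_⇔_; mk⇔; Equivalence)
open import Function.Properties.Equivalence using () renaming (trans to ⇔-trans; sym to ⇔-sym)

open Equivalence using (to; from)

true≢false : ∀ {b} → b ≡ true → b ≡ false → ⊥
true≢false refl ()

≡-from-true⇔ : ∀ {a b : Bool} → (a ≡ true ⇔ b ≡ true) → a ≡ b
≡-from-true⇔ {true}           a⇔b = sym (to a⇔b refl)
≡-from-true⇔ {false} {false} _   = refl
≡-from-true⇔ {false} {true}  a⇔b = from a⇔b refl

does-⇔ : ∀ {p} {P : Set p} (P? : Dec P) → does P? ≡ true ⇔ P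
does-⇔ P? = mk⇔ (sound P?) (dec-true P?)
  where
    sound : ∀ {p} {P : Set p} (P? : Dec P) → does P? ≡ true → P
    sound (yes p) _ = p
    sound (no _) ()

counterexample : ∀ {k p q} {P : Pred (Fin k) p} {Q : Pred (Fin k) q} →
  Decidable P → Decidable Q → ¬ (∀ i → P i → Q i) → ∃ λ i → P i × ¬ Q i
counterexample {k} P? Q? fails with ¬∀⟶∃¬ k _ (λ i → P? i →-dec Q? i) fails
... | i , ¬P⇒Q = i , decidable-stable (P? i) (λ ¬Pi → ¬P⇒Q (λ Pi → contradiction Pi ¬Pi))
                   , (λ Qi → ¬P⇒Q (λ _ → Qi))

-- Subsets and points.  A subset of Fin n is a Boolean vector, so it is read as
-- a point by lookup, and a point is read as a subset by tabulate.

lookup-∈ : ∀ {n} {K : Subset n} {a} → lookup K a ≡ true ⇔ a ∈ K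
lookup-∈ {K = K} {a} = mk⇔ (lookup⇒[]= a K) []=⇒lookup

∈-tabulate : ∀ {n} (f : Fin n → Bool) {a} → a ∈ tabulate f ⇔ f a ≡ true
∈-tabulate f {a} = mk⇔
  (λ a∈ → trans (sym (lookup∘tabulate f a)) ([]=⇒lookup a∈))
  (λ fa → lookup⇒[]= a (tabulate f) (trans (lookup∘tabulate f a) fa))

_covers_ : ∀ {n} → Point n → Subset n → Set
x covers K = ∀ a → a ∈ K → x a ≡ true

pair : ∀ {n} → Fin n → Fin n → Subset n
pair u v = ⁅ u ⁆ ∪ ⁅ v ⁆

module _ {n : ℕ} where

  ∈pair⁻ : ∀ {u v a : Fin n} → a ∈ pair u v → a ≡ u ⊎ a ≡ v
  ∈pair⁻ {u} {v} a∈ = [ (λ a∈u → inj₁ (x∈⁅y⁆⇒x≡y u a∈u)) , (λ a∈v → inj₂ (x∈⁅y⁆⇒x≡y v a∈v)) ]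
                (x∈p∪q⁻ ⁅ u ⁆ ⁅ v ⁆ a∈)

  ∈pair-left : ∀ {u v : Fin n} → u ∈ pair u v
  ∈pair-left {u} = x∈p∪q⁺ (inj₁ (x∈⁅x⁆ u))

  ∈pair-right : ∀ {u v : Fin n} → v ∈ pair u v
  ∈pair-right {v = v} = x∈p∪q⁺ (inj₂ (x∈⁅x⁆ v))

  pair⊆ : ∀ {u v K} → u ∈ K → v ∈ K → pair u v ⊆ K
  pair⊆ u∈K v∈K a∈ with ∈pair⁻ a∈
  ... | inj₁ refl = u∈K
  ... | inj₂ refl = v∈K

  covers-pair : ∀ {u v} {x : Point n} → x u ≡ true → x v ≡ true → x covers pair u v
  covers-pair xu xv a a∈ with ∈pair⁻ a∈
  ... | inj₁ refl = xu
  ... | inj₂ refl = xv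

  pair-spanned : ∀ {u v a b : Fin n} → a ∈ pair u v → b ∈ pair u v → a ≢ b → pair u v ⊆ pair a b
  pair-spanned a∈ b∈ a≢b with ∈pair⁻ a∈ | ∈pair⁻ b∈
  ... | inj₁ refl | inj₁ refl = ⊥-elim (a≢b refl)
  ... | inj₁ refl | inj₂ refl = ⊆-refl
  ... | inj₂ refl | inj₁ refl = pair⊆ ∈pair-right ∈pair-left
  ... | inj₂ refl | inj₂ refl = ⊥-elim (a≢b refl)

satClause? : ∀ {n} (x : Point n) (c : HornClause n) → Dec (SatClause x c)
satClause? x (A , v) = all? (λ a → (a ∈? A) →-dec (x a ≟ᵇ true)) →-dec (x v ≟ᵇ true)

hornFunction : ∀ {n} → List (HornClause n) → BoolFun n
hornFunction cs x = does (All.all? (satClause? x) cs)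

hornFunction-true : ∀ {n} (cs : List (HornClause n)) {x} →
  hornFunction cs x ≡ true ⇔ All (SatClause x) cs
hornFunction-true cs {x} = does-⇔ (All.all? (satClause? x) cs)

hornFunction-pure : ∀ {n} (cs : List (HornClause n)) → PureHorn (hornFunction cs)
hornFunction-pure cs = cs , λ x → hornFunction-true cs

clause⇒implicate : ∀ {n} {h : BoolFun n} (ph : PureHorn h) {A v} →
  (A , v) ∈ˡ proj₁ ph → Implicate h A v
clause⇒implicate ph c∈ y hy = All.lookup (to (proj₂ ph y) hy) c∈

module _ {n} (h : BoolFun n) where

  counterpoint⇒notKey : ∀ {K y w} → h y ≡ true → y covers K → y w ≡ false → ¬ Key h K
  counterpoint⇒notKey {K} {y} {w} hy yK yw key = true≢false (key w w∉K y hy yK) yw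
    where
      w∉K : w ∉ K
      w∉K w∈K = true≢false (yK w w∈K) yw

  minimalKey⊆ : ∀ {K K′} → MinimalKey h K → Key h K′ → K′ ⊆ K → K ⊆ K′
  minimalKey⊆ {K} {K′} (_ , minimal) key′ K′⊆K {a} a∈K with a ∈? K′
  ... | yes a∈K′ = a∈K′
  ... | no a∉K′ = ⊥-elim (minimal K′ (K′⊆K , a , a∈K , a∉K′) key′)

  -- Every key contains a minimal key.  Keyhood is not decided here, so this is
  -- stated negatively; it follows by well-founded induction on ⊂.
  keyContainsMinimalKey : ∀ K → Key h K → ¬ (∀ K′ → K′ ⊆ K → ¬ MinimalKey h K′)
  keyContainsMinimalKey K = descend K (⊂-wellFounded K)
    where
      descend : ∀ K → Acc _⊂_ K → Key h K → ¬ (∀ K′ → K′ ⊆ K → ¬ MinimalKey h K′)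
      descend K (acc smaller) key none = none K ⊆-refl (key , λ K′ K′⊂K key′ →
        descend K′ (smaller K′⊂K) key′ (λ K″ K″⊆K′ → none K″ (⊆-trans K″⊆K′ (proj₁ K′⊂K))))

module _ {m} (G : Graph m) where

  Edge : Fin m → Fin m → Set
  Edge u v = adj G u v ≡ true

  Independent : Subset m → Set
  Independent K = ∀ {u v} → Edge u v → u ∈ K → v ∈ K → ⊥

  EdgeClosed : Point m → Set
  EdgeClosed x = ∀ {u v} → Edge u v → x u ≡ true → x v ≡ true → ∀ z → x z ≡ true

  edge-distinct : ∀ {u v} → Edge u v → u ≢ v
  edge-distinct {u} e refl = true≢false e (irrefl G u)

  independentOrEdge : ∀ K → Independent K ⊎ ∃ λ u → ∃ λ v → Edge u v × u ∈ K × v ∈ K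
  independentOrEdge K
    with any? (λ u → any? (λ v → (adj G u v ≟ᵇ true) ×-dec ((u ∈? K) ×-dec (v ∈? K))))
  ... | yes edge = inj₂ edge
  ... | no none  = inj₁ (λ {u} {v} e u∈K v∈K → none (u , v , e , u∈K , v∈K))

  ⊂pair⇒independent : ∀ {K u v} → K ⊂ pair u v → Independent K
  ⊂pair⇒independent (K⊆uv , z , z∈uv , z∉K) e a∈K b∈K =
    z∉K (pair⊆ a∈K b∈K (pair-spanned (K⊆uv a∈K) (K⊆uv b∈K) (edge-distinct e) z∈uv))

  independent-∪ : ∀ {A u} → Independent A → (∀ {b} → Edge u b → b ∉ A) →
    Independent (A ∪ ⁅ u ⁆)
  independent-∪ {A} {u} indepA away {a} {b} e a∈ b∈
    with x∈p∪q⁻ A ⁅ u ⁆ a∈ | x∈p∪q⁻ A ⁅ u ⁆ b∈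
  ... | inj₁ a∈A | inj₁ b∈A = indepA e a∈A b∈A
  ... | inj₂ a∈u | inj₁ b∈A = away (subst (λ q → Edge q b) (x∈⁅y⁆⇒x≡y u a∈u) e) b∈A
  ... | inj₁ a∈A | inj₂ b∈u =
    away (subst (λ q → Edge q a) (x∈⁅y⁆⇒x≡y u b∈u) (Graph.sym G a b e)) a∈A
  ... | inj₂ a∈u | inj₂ b∈u =
    edge-distinct e (trans (x∈⁅y⁆⇒x≡y u a∈u) (sym (x∈⁅y⁆⇒x≡y u b∈u)))

  closed⇒independent : ∀ {x K w} → EdgeClosed x → x w ≡ false → x covers K → Independent K
  closed⇒independent {w = w} closed xw xK e u∈K v∈K =
    true≢false (closed e (xK _ u∈K) (xK _ v∈K) w) xw

  independent⇒closed : ∀ {K} → Independent K → EdgeClosed (lookup K)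
  independent⇒closed indep e ku kv _ = ⊥-elim (indep e (to lookup-∈ ku) (to lookup-∈ kv))

  edgeKeys⇔closedPoints : ∀ h →
    (∀ {u v} → Edge u v → Key h (pair u v)) ⇔ (∀ {y} → h y ≡ true → EdgeClosed y)
  edgeKeys⇔closedPoints h = mk⇔ keys⇒closed closed⇒keys
    where
      keys⇒closed : (∀ {u v} → Edge u v → Key h (pair u v)) → ∀ {y} → h y ≡ true → EdgeClosed y
      keys⇒closed edgeKey {y} hy {u} {v} e yu yv z with z ∈? pair u v
      ... | yes z∈ = covers-pair yu yv z z∈
      ... | no z∉  = edgeKey e z z∉ y hy (covers-pair yu yv)

      closed⇒keys : (∀ {y} → h y ≡ true → EdgeClosed y) → ∀ {u v} → Edge u v → Key h (pair u v)
      closed⇒keys closed e w _ y hy yK = closed hy e (yK _ ∈pair-left) (yK _ ∈pair-right) w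

  independent-misses : ∀ {u₀ v₀ K} → Edge u₀ v₀ → Independent K → ∃ λ w → lookup K w ≡ false
  independent-misses {u₀} {v₀} {K} e₀ indep with u₀ ∈? K | v₀ ∈? K
  ... | yes u∈K | yes v∈K = ⊥-elim (indep e₀ u∈K v∈K)
  ... | no u∉K  | _       = u₀ , ¬-not (λ ku → u∉K (to lookup-∈ ku))
  ... | yes _   | no v∉K  = v₀ , ¬-not (λ kv → v∉K (to lookup-∈ kv))

  independentExtension⇒notKey : ∀ {h u₀ v₀ K J} → Edge u₀ v₀ → Independent J → K ⊆ J →
    h (lookup J) ≡ true → ¬ Key h K
  independentExtension⇒notKey {h} e₀ indepJ K⊆J hJ with independent-misses e₀ indepJ
  ... | w , jw = counterpoint⇒notKey h hJ (λ a a∈K → from lookup-∈ (K⊆J a∈K)) jw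

  -- The minimal keys of h are the edges if every edge is a key and no independent
  -- set is: a minimal key contains an edge, which is a key, hence equals it.
  keysAreEdges : ∀ h → (∀ {u v} → Edge u v → Key h (pair u v)) →
    (∀ K → Independent K → ¬ Key h K) → KeysEqual h (EdgeHypergraph G)
  keysAreEdges h edgeKey independentNotKey K = mk⇔ minimal⇒edge edge⇒minimal
    where
      minimal⇒edge : MinimalKey h K → EdgeHypergraph G K
      minimal⇒edge minimal with independentOrEdge K
      ... | inj₁ indep = ⊥-elim (independentNotKey K indep (proj₁ minimal))
      ... | inj₂ (u , v , e , u∈K , v∈K) =
        u , v , e , ⊆-antisym (minimalKey⊆ h minimal (edgeKey e) uv⊆K) uv⊆K
        where
          uv⊆K : pair u v ⊆ K
          uv⊆K = pair⊆ u∈K v∈K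

      edge⇒minimal : EdgeHypergraph G K → MinimalKey h K
      edge⇒minimal (u , v , e , refl) =
        edgeKey e , λ K′ K′⊂uv → independentNotKey K′ (⊂pair⇒independent K′⊂uv)

  edgeIsKey : ∀ {h} → KeysEqual h (EdgeHypergraph G) → ∀ {u v} → Edge u v → Key h (pair u v)
  edgeIsKey keys {u} {v} e = proj₁ (from (keys (pair u v)) (u , v , e , refl))

  independentNotKey : ∀ {h} → KeysEqual h (EdgeHypergraph G) → ∀ K → Independent K → ¬ Key h K
  independentNotKey {h} keys K indep key = keyContainsMinimalKey h K key noEdgeBelow
    where
      noEdgeBelow : ∀ K′ → K′ ⊆ K → ¬ MinimalKey h K′
      noEdgeBelow K′ K′⊆K minimal with to (keys K′) minimal
      ... | u , v , e , refl = indep e (K′⊆K ∈pair-left) (K′⊆K ∈pair-right)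

  EdgeTriple : Fin m × Fin m × Fin m → Set
  EdgeTriple (u , v , _) = Edge u v

  edgeTriple? : Decidable EdgeTriple
  edgeTriple? (u , v , _) = adj G u v ≟ᵇ true

  allTriples : List (Fin m × Fin m × Fin m)
  allTriples = cartesianProduct (allFin m) (cartesianProduct (allFin m) (allFin m))

  edgeTriples : List (Fin m × Fin m × Fin m)
  edgeTriples = filter edgeTriple? allTriples

  edgeClause : Fin m × Fin m × Fin m → HornClause m
  edgeClause (u , v , z) = pair u v , z

  edgeClauses : List (HornClause m)
  edgeClauses = map edgeClause edgeTriples

  ∈-edgeTriples : ∀ {u v} z → Edge u v → (u , v , z) ∈ˡ edgeTriples
  ∈-edgeTriples {u} {v} z e = ∈-filter⁺ edgeTriple?
    (∈-cartesianProduct⁺ (∈-allFin u) (∈-cartesianProduct⁺ (∈-allFin v) (∈-allFin z))) e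

  edgeClauses⇔closed : ∀ {x} → All (SatClause x) edgeClauses ⇔ EdgeClosed x
  edgeClauses⇔closed {x} = mk⇔ toClosed (λ closed → All.tabulate (fromClosed closed))
    where
      toClosed : All (SatClause x) edgeClauses → EdgeClosed x
      toClosed sat e xu xv z =
        All.lookup sat (∈-map⁺ edgeClause (∈-edgeTriples z e)) (covers-pair xu xv)

      fromClosed : EdgeClosed x → ∀ {c} → c ∈ˡ edgeClauses → SatClause x c
      fromClosed closed c∈ with ∈-map⁻ edgeClause c∈
      ... | (u , v , z) , t∈ , refl = λ xuv →
        closed (proj₂ (∈-filter⁻ edgeTriple? {xs = allTriples} t∈))
               (xuv u ∈pair-left) (xuv v ∈pair-right) z

  closureFunction : BoolFun m
  closureFunction = hornFunction edgeClauses

  closureFunction-true : ∀ {x} → closureFunction x ≡ true ⇔ EdgeClosed x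
  closureFunction-true = ⇔-trans (hornFunction-true edgeClauses) edgeClauses⇔closed

  closureFunction-keys : ∀ {u₀ v₀} → Edge u₀ v₀ → KeysEqual closureFunction (EdgeHypergraph G)
  closureFunction-keys e₀ = keysAreEdges closureFunction
    (from (edgeKeys⇔closedPoints closureFunction) (to closureFunction-true))
    (λ K indep → independentExtension⇒notKey e₀ indep ⊆-refl
                   (from closureFunction-true (independent⇒closed indep)))

  -- Let v have a neighbour u whose only neighbour is v.  If the minimal keys of h
  -- are the edges, h has no implicate A → v with A independent and v ∉ A:
  -- otherwise A ∪ {u} would be an independent key.
  noIndependentImplicate : ∀ {h} → KeysEqual h (EdgeHypergraph G) →
    ∀ {v u} → Edge v u → (∀ {b} → Edge u b → b ≡ v) →
    ∀ {A} → Independent A → v ∉ A → ¬ Implicate h A v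
  noIndependentImplicate {h} keys {v} {u} vu onlyV {A} indepA v∉A implicate =
    independentNotKey keys (A ∪ ⁅ u ⁆) (independent-∪ indepA away) key
    where
      away : ∀ {b} → Edge u b → b ∉ A
      away ub b∈A = v∉A (subst (_∈ A) (onlyV ub) b∈A)

      key : Key h (A ∪ ⁅ u ⁆)
      key w _ y hy yK = to (edgeKeys⇔closedPoints h) (edgeIsKey keys) hy vu
        (implicate y hy (λ a a∈A → yK a (x∈p∪q⁺ (inj₁ a∈A))))
        (yK u (x∈p∪q⁺ (inj₂ (x∈⁅x⁆ u)))) w

  partnerIsPendant : PerfectMatching G → ∀ v → ∃ λ u → Edge v u × (∀ {b} → Edge u b → b ≡ v)
  partnerIsPendant pm v with pm v
  ... | u , vu , _ with pm u
  ...   | _ , _ , onlyU′ = u , vu , λ ub → trans (onlyU′ _ ub) (sym (onlyU′ v (Graph.sym G v u vu)))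

  perfectMatching⇒true⇔closed : PerfectMatching G → ∀ {h} → PureHorn h →
    KeysEqual h (EdgeHypergraph G) → ∀ {x} → h x ≡ true ⇔ EdgeClosed x
  perfectMatching⇒true⇔closed pm {h} ph keys {x} =
    mk⇔ (to (edgeKeys⇔closedPoints h) (edgeIsKey keys)) closed⇒true
    where
      closed⇒true : EdgeClosed x → h x ≡ true
      closed⇒true closed = from (proj₂ ph x) (All.tabulate satisfied)
        where
          satisfied : ∀ {c} → c ∈ˡ proj₁ ph → SatClause x c
          satisfied {A , v} c∈ xA with x v in xv | partnerIsPendant pm v
          ... | true  | _ = refl
          ... | false | u , vu , onlyV = ⊥-elim (noIndependentImplicate keys vu onlyV
                  (closed⇒independent closed xv xA) (λ v∈A → true≢false (xA v v∈A) xv)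
                  (clause⇒implicate ph c∈))

  perfectMatching⇒unique : PerfectMatching G → Fin m → UniqueKeyGraph G
  perfectMatching⇒unique pm v₀ =
    (closureFunction , hornFunction-pure edgeClauses , closureFunction-keys (proj₁ (proj₂ (pm v₀))))
    , λ h₁ h₂ ph₁ keys₁ ph₂ keys₂ x → ≡-from-true⇔
        (⇔-trans (perfectMatching⇒true⇔closed pm ph₁ keys₁)
                 (⇔-sym (perfectMatching⇒true⇔closed pm ph₂ keys₂)))

  NoPendantNeighbour : Fin m → Set
  NoPendantNeighbour w = ∀ {u} → Edge w u → ∃ λ y → Edge u y × y ≢ w

  -- Let c be a proper 2-colouring, w a vertex with no pendant neighbour, and I the
  -- other vertices of w's colour.  Strengthening the closure function by the clause
  -- I → w keeps the edges as minimal keys but rejects the independent set I.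
  module NonUniqueness (c : Fin m → Bool) (proper : ∀ u v → Edge u v → c u ≢ c v)
                       {w} (noPendant : NoPendantNeighbour w) {u₀ v₀} (e₀ : Edge u₀ v₀) where

    SameSide : Fin m → Set
    SameSide a = c a ≡ c w × a ≢ w

    I : Subset m
    I = tabulate (λ a → does ((c a ≟ᵇ c w) ×-dec ¬? (a ≟ᶠ w)))

    ∈I : ∀ {a} → a ∈ I ⇔ SameSide a
    ∈I {a} = ⇔-trans (∈-tabulate _) (does-⇔ ((c a ≟ᵇ c w) ×-dec ¬? (a ≟ᶠ w)))

    independentI : Independent I
    independentI {a} {b} e a∈I b∈I =
      proper a b e (trans (proj₁ (to ∈I a∈I)) (sym (proj₁ (to ∈I b∈I))))

    strengthened : BoolFun m
    strengthened = hornFunction ((I , w) ∷ edgeClauses)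

    strengthened-true : ∀ {x} → strengthened x ≡ true ⇔ (SatClause x (I , w) × EdgeClosed x)
    strengthened-true {x} = ⇔-trans (hornFunction-true ((I , w) ∷ edgeClauses))
      (mk⇔ (λ { (sat ∷ sats) → sat , to edgeClauses⇔closed sats })
           (λ { (sat , closed) → sat ∷ from edgeClauses⇔closed closed }))

    -- An independent K ⊇ I has no vertex adjacent to w: such a vertex b has a
    -- neighbour y ≠ w, which has w's colour, so y ∈ I ⊆ K.
    awayFromW : ∀ {K} → Independent K → I ⊆ K → ∀ {b} → Edge w b → b ∉ K
    awayFromW indep I⊆K wb b∈K with noPendant wb
    ... | y , by , y≢w = indep by b∈K (I⊆K (from ∈I (sameSide , y≢w)))
      where
        sameSide : c y ≡ c w
        sameSide = trans (¬-not (≢-sym (proper _ y by))) (sym (¬-not (proper w _ wb)))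

    -- No independent set K is a key: if I ⊈ K the point of K satisfies I → w
    -- vacuously, otherwise the point of the independent set K ∪ {w} satisfies it.
    independentNotKey′ : ∀ K → Independent K → ¬ Key strengthened K
    independentNotKey′ K indep with I ⊆? K
    ... | no I⊈K = independentExtension⇒notKey e₀ indep ⊆-refl
      (from strengthened-true (vacuous , independent⇒closed indep))
      where
        vacuous : SatClause (lookup K) (I , w)
        vacuous covered = ⊥-elim (I⊈K (λ {a} a∈I → to lookup-∈ (covered a a∈I)))
    ... | yes I⊆K = independentExtension⇒notKey e₀ indepKw (p⊆p∪q ⁅ w ⁆)
      (from strengthened-true
        ((λ _ → from lookup-∈ (x∈p∪q⁺ {p = K} (inj₂ (x∈⁅x⁆ w)))) , independent⇒closed indepKw))
      where
        indepKw : Independent (K ∪ ⁅ w ⁆)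
        indepKw = independent-∪ indep (awayFromW indep I⊆K)

    strengthened-keys : KeysEqual strengthened (EdgeHypergraph G)
    strengthened-keys = keysAreEdges strengthened
      (from (edgeKeys⇔closedPoints strengthened) (λ hy → proj₂ (to strengthened-true hy)))
      independentNotKey′

    -- The point of I is accepted by the closure function but rejected by the
    -- strengthened function, as w ∉ I.
    notUnique : ¬ UniqueKeyGraph G
    notUnique (_ , unique) = proj₂ (to ∈I (to lookup-∈ (clauseIw (λ a → from lookup-∈)))) refl
      where
        agree : closureFunction (lookup I) ≡ strengthened (lookup I)
        agree = unique closureFunction strengthened
          (hornFunction-pure edgeClauses) (closureFunction-keys e₀)
          (hornFunction-pure ((I , w) ∷ edgeClauses)) strengthened-keys (lookup I)

        clauseIw : SatClause (lookup I) (I , w)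
        clauseIw = proj₁ (to strengthened-true
          (trans (sym agree) (from closureFunction-true (independent⇒closed independentI))))

  Fork : Set
  Fork = ∃ λ v → ∃ λ a → ∃ λ b → Edge v a × Edge v b × a ≢ b

  perfectMatchingOrFork : NoIsolatedVertices G → PerfectMatching G ⊎ Fork
  perfectMatchingOrFork noIsolated = decide (all? onlyNeighbour?)
    where
      partner : Fin m → Fin m
      partner v = proj₁ (noIsolated v)

      onlyNeighbour? : ∀ v → Dec (∀ b → Edge v b → b ≡ partner v)
      onlyNeighbour? v = all? (λ b → (adj G v b ≟ᵇ true) →-dec (b ≟ᶠ partner v))

      decide : Dec (∀ v → ∀ b → Edge v b → b ≡ partner v) → PerfectMatching G ⊎ Fork
      decide (yes only) = inj₁ (λ v → partner v , proj₂ (noIsolated v) , only v)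
      decide (no notOnly) with ¬∀⟶∃¬ m _ onlyNeighbour? notOnly
      ... | v , ¬only with counterexample (λ b → adj G v b ≟ᵇ true) (λ b → b ≟ᶠ partner v) ¬only
      ...   | b , vb , b≢a = inj₂ (v , partner v , b , proj₂ (noIsolated v) , vb , ≢-sym b≢a)

  -- In a fork at v with neighbour a, either a has no pendant neighbour, or some
  -- neighbour ℓ of a is adjacent to a only; then ℓ has no pendant neighbour,
  -- since a is also adjacent to v ≠ ℓ.
  fork⇒noPendantNeighbour : Fork → ∃ NoPendantNeighbour
  fork⇒noPendantNeighbour (v , a , b , va , vb , a≢b) =
    decide (all? (λ u → (adj G a u ≟ᵇ true) →-dec otherNeighbour? u))
    where
      otherNeighbour? : ∀ u → Dec (∃ λ y → Edge u y × y ≢ a)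
      otherNeighbour? u = any? (λ y → (adj G u y ≟ᵇ true) ×-dec ¬? (y ≟ᶠ a))

      pendant⇒noPendantNeighbour : ∀ {ℓ} → (∀ {y} → Edge ℓ y → y ≡ a) → NoPendantNeighbour ℓ
      pendant⇒noPendantNeighbour onlyA ℓu with onlyA ℓu
      ... | refl = v , Graph.sym G v a va ,
                   λ v≡ℓ → a≢b (sym (onlyA (subst (λ q → Edge q b) v≡ℓ vb)))

      decide : Dec (∀ u → Edge a u → ∃ λ y → Edge u y × y ≢ a) → ∃ NoPendantNeighbour
      decide (yes ok) = a , λ {u} au → ok u au
      decide (no notOk) with counterexample (λ u → adj G a u ≟ᵇ true) otherNeighbour? notOk
      ... | ℓ , _ , ¬other = ℓ , pendant⇒noPendantNeighbour
        (λ {y} ℓy → decidable-stable (y ≟ᶠ a) (λ y≢a → ¬other (y , ℓy , y≢a)))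

  fork⇒notUnique : Bipartite G → Fork → ¬ UniqueKeyGraph G
  fork⇒notUnique (c , proper) fork@(_ , _ , _ , va , _) with fork⇒noPendantNeighbour fork
  ... | _ , noPendant = NonUniqueness.notUnique c proper noPendant va

theorem4 : ∀ {n} (G : Graph (suc n)) → Bipartite G → NoIsolatedVertices G →
    (UniqueKeyGraph G ⇔ PerfectMatching G)
theorem4 G bipartite noIsolated = mk⇔ unique⇒matching matching⇒unique
  where
    unique⇒matching : UniqueKeyGraph G → PerfectMatching G
    unique⇒matching unique =
      [ id , (λ fork → ⊥-elim (fork⇒notUnique G bipartite fork unique)) ]
        (perfectMatchingOrFork G noIsolated)

    matching⇒unique : PerfectMatching G → UniqueKeyGraph G
    matching⇒unique pm = perfectMatching⇒unique G pm zero
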